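{- Let $x,y$ be nonzero complex numbers. Then for every integer $n\geq 0$, $$\mathfrak{F}_{n}(x,y)=y^{n}\sum_{k=0}^{n}y^{k}\binom{n}{k}(-1)^{k}\,\omega_{n-k}\!\left(\frac{x}{y},y\right).$$
   Context: The generalized Fubini polynomials $\mathfrak{F}_n(x,y)$ are defined by $\sum_{n\geq0}\mathfrak{F}_n(x,y)\frac{t^n}{n!}=\frac{1}{1-\frac{x}{y}(e^{ty}-1)}$ (equivalently $\mathfrak{F}_n(x,y)=\sum_{k=0}^n{n\brace k}k!x^ky^{n-k}$, ${n\brace k}$ the Stirling numbers of the second kind). The two-variable Fubini polynomials $\omega_n(x,y)$ are defined by $\sum_{n\geq0}\omega_n(x,y)\frac{t^n}{n!}=\frac{e^{ty}}{1-x(e^{t}-1)}$. -}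

module Defs where

open import Level using (Level)
open import Data.Nat as ℕ using (ℕ; zero; suc; _∸_)
open import Data.Nat.Combinatorics using (_C_)
open import Data.Nat using (_!)
open import Algebra.Bundles using (CommutativeRing; Semiring)

S₂ : ℕ → ℕ → ℕ
S₂ zero    zero    = 1
S₂ zero    (suc k) = 0
S₂ (suc n) zero    = 0
S₂ (suc n) (suc k) = suc k ℕ.* S₂ n (suc k) ℕ.+ S₂ n k

module FubiniDefs {c ℓ : Level} (R : CommutativeRing c ℓ) where
  open CommutativeRing R hiding (zero)
  open import Algebra.Definitions.RawSemiring (Semiring.rawSemiring semiring) using (_×_; _^_)

  sumTo : ℕ → (ℕ → Carrier) → Carrier
  sumTo zero    f = f zero
  sumTo (suc n) f = sumTo n f + f (suc n)

  𝔉 : ℕ → Carrier → Carrier → Carrier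
  𝔉 n x y = sumTo n (λ k → ((S₂ n k ℕ.* (k !)) × (x ^ k)) * (y ^ (n ∸ k)))

  -- ordinary Fubini polynomial  F_n(x) = Σ_k {n brace k} k! x^k,
  -- the EGF coefficients of 1/(1 - x(e^t - 1))
  fubini : ℕ → Carrier → Carrier
  fubini n x = sumTo n (λ k → (S₂ n k ℕ.* (k !)) × (x ^ k))

  -- two-variable Fubini polynomial ω_n(x,y): the n-th EGF coefficient of
  -- e^{ty} · 1/(1 - x(e^t - 1)), i.e. the binomial convolution
  -- ω_n(x,y) = Σ_j C(n,j) y^(n-j) F_j(x)
  ω : ℕ → Carrier → Carrier → Carrier
  ω n x y = sumTo n (λ j → ((n C j) × (y ^ (n ∸ j))) * fubini j x)

  pow : Carrier → ℕ → Carrier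
  pow = _^_

  natMul : ℕ → Carrier → Carrier
  natMul = _×_

-- For a ∈ R let T_a be the binomial transform (T_a u)(n) = Σ_k C(n,k) a^k u(n-k) of sequences.
-- These operators compose additively, T_a ∘ T_b = T_(a+b), and T_0 is the identity.
-- With z = x/y and F_j = F_j(z) the ordinary Fubini polynomials at z, ω_m(z,y) = (T_y F)(m) and the
-- alternating sum on the right is (T_(-y) (T_y F))(n) = F_n(z); finally y^n F_n(x/y) = 𝔉_n(x,y).
module Submission where

open import Defs
open import Level using (Level)
open import Data.Nat using (ℕ; _∸_)
open import Data.Nat.Combinatorics using (_C_)
open import Relation.Nullary using (¬_)
open import Algebra.Bundles using (CommutativeRing)

open import Data.Nat as ℕ using (zero; suc; _≤_; z≤n; _!)
import Data.Nat.Properties as ℕ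
import Data.Nat.Combinatorics as ℕ
import Data.Nat.Combinatorics.Specification as ℕ
import Relation.Binary.PropositionalEquality as ≡

module BinomialTransform {c ℓ : Level} (R : CommutativeRing c ℓ) where
  open CommutativeRing R hiding (zero)
  open FubiniDefs R
  open import Algebra.Properties.Semiring.Mult semiring
  open import Algebra.Properties.CommutativeSemiring.Exp commutativeSemiring
  open import Algebra.Properties.Ring ring using (-1*x≈-x)
  import Algebra.Properties.CommutativeSemigroup as CommSemigroupProperties
  module +-Comm = CommSemigroupProperties +-commutativeSemigroup
  module *-Comm = CommSemigroupProperties *-commutativeSemigroup
  open import Relation.Binary.Reasoning.Setoid setoid

  Seq : Set c
  Seq = ℕ → Carrier

  sumTo-cong : ∀ n {f g : Seq} → (∀ k → k ≤ n → f k ≈ g k) → sumTo n f ≈ sumTo n g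
  sumTo-cong zero    f≈g = f≈g 0 z≤n
  sumTo-cong (suc n) f≈g =
    +-cong (sumTo-cong n (λ k k≤n → f≈g k (ℕ.m≤n⇒m≤1+n k≤n))) (f≈g (suc n) ℕ.≤-refl)

  sumTo-+ : ∀ n (f g : Seq) → sumTo n (λ k → f k + g k) ≈ sumTo n f + sumTo n g
  sumTo-+ zero    f g = refl
  sumTo-+ (suc n) f g = trans (+-congʳ (sumTo-+ n f g)) (+-Comm.interchange _ _ _ _)

  *-distribˡ-sumTo : ∀ n a (f : Seq) → a * sumTo n f ≈ sumTo n (λ k → a * f k)
  *-distribˡ-sumTo zero    a f = refl
  *-distribˡ-sumTo (suc n) a f = trans (distribˡ a _ _) (+-congʳ (*-distribˡ-sumTo n a f))

  sumTo-suc-head : ∀ n (f : Seq) → sumTo (suc n) f ≈ f 0 + sumTo n (λ k → f (suc k))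
  sumTo-suc-head zero    f = refl
  sumTo-suc-head (suc n) f = trans (+-congʳ (sumTo-suc-head n f)) (+-assoc _ _ _)

  sumTo-extendʳ : ∀ n {f g : Seq} → (∀ k → k ≤ n → f k ≈ g k) → g (suc n) ≈ 0# →
                  sumTo n f ≈ sumTo (suc n) g
  sumTo-extendʳ n f≈g g[1+n]≈0 = begin
    sumTo n _          ≈⟨ sumTo-cong n f≈g ⟩
    sumTo n _          ≈⟨ +-identityʳ _ ⟨
    sumTo n _ + 0#     ≈⟨ +-congˡ g[1+n]≈0 ⟨
    sumTo (suc n) _    ∎

  nC[1+n]×≈0 : ∀ n w → natMul (n C suc n) w ≈ 0#
  nC[1+n]×≈0 n w = reflexive (≡.cong (λ m → natMul m w) (ℕ.k>n⇒nCk≡0 (ℕ.n<1+n n)))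

  pascal× : ∀ n k w → natMul (suc n C suc k) w ≈ natMul (n C k) w + natMul (n C suc k) w
  pascal× n k w = trans
    (reflexive (≡.cong (λ m → natMul m w) (≡.sym (ℕ.nCk+nC[k+1]≡[n+1]C[k+1] n k))))
    (×-homo-+ w (n C k) (n C suc k))

  shift : Seq → Seq
  shift u m = u (suc m)

  -- T_a defined through its Pascal recursion, which is what makes composition provable by induction.
  transform : Carrier → Seq → Seq
  transform a u zero    = u zero
  transform a u (suc n) = transform a (shift u) n + a * transform a u n

  transform-cong : ∀ a n {u v : Seq} → (∀ m → u m ≈ v m) → transform a u n ≈ transform a v n
  transform-cong a zero    u≈v = u≈v 0
  transform-cong a (suc n) u≈v =
    +-cong (transform-cong a n (λ m → u≈v (suc m))) (*-congˡ (transform-cong a n u≈v))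

  transform-unique : ∀ a (Q : Seq → Seq) → (∀ u → Q u 0 ≈ u 0) →
                     (∀ u n → Q u (suc n) ≈ Q (shift u) n + a * Q u n) →
                     ∀ n u → Q u n ≈ transform a u n
  transform-unique a Q Q0 Q-suc zero    u = Q0 u
  transform-unique a Q Q0 Q-suc (suc n) u = trans (Q-suc u n)
    (+-cong (transform-unique a Q Q0 Q-suc n (shift u)) (*-congˡ (transform-unique a Q Q0 Q-suc n u)))

  private
    +-*-interchange : ∀ p q r s a b →
                      (p + b * q) + a * (r + b * s) ≈ (p + a * r) + b * (q + a * s)
    +-*-interchange p q r s a b = begin
      (p + b * q) + a * (r + b * s)        ≈⟨ +-congˡ (distribˡ a r (b * s)) ⟩
      (p + b * q) + (a * r + a * (b * s))  ≈⟨ +-Comm.interchange _ _ _ _ ⟩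
      (p + a * r) + (b * q + a * (b * s))  ≈⟨ +-congˡ (+-congˡ (*-Comm.x∙yz≈y∙xz a b s)) ⟩
      (p + a * r) + (b * q + b * (a * s))  ≈⟨ +-congˡ (distribˡ b q (a * s)) ⟨
      (p + a * r) + b * (q + a * s)        ∎

  transform-linear : ∀ a b n (u v : Seq) →
                     transform a (λ m → u m + b * v m) n ≈ transform a u n + b * transform a v n
  transform-linear a b zero    u v = refl
  transform-linear a b (suc n) u v =
    trans (+-cong (transform-linear a b n (shift u) (shift v)) (*-congˡ (transform-linear a b n u v)))
          (+-*-interchange _ _ _ _ a b)

  transform-∘ : ∀ a b n (u : Seq) → transform a (transform b u) n ≈ transform (a + b) u n
  transform-∘ a b zero    u = refl
  transform-∘ a b (suc n) u = begin
    transform a (λ m → transform b (shift u) m + b * transform b u m) n + a * transform a (transform b u) n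
      ≈⟨ +-congʳ (transform-linear a b n (transform b (shift u)) (transform b u)) ⟩
    (transform a (transform b (shift u)) n + b * transform a (transform b u) n) + a * transform a (transform b u) n
      ≈⟨ +-cong (+-cong (transform-∘ a b n (shift u)) (*-congˡ (transform-∘ a b n u)))
                (*-congˡ (transform-∘ a b n u)) ⟩
    (transform (a + b) (shift u) n + b * T) + a * T   ≈⟨ +-assoc _ _ _ ⟩
    transform (a + b) (shift u) n + (b * T + a * T)   ≈⟨ +-congˡ (distribʳ T b a) ⟨
    transform (a + b) (shift u) n + (b + a) * T       ≈⟨ +-congˡ (*-congʳ (+-comm b a)) ⟩
    transform (a + b) (shift u) n + (a + b) * T       ∎
    where T = transform (a + b) u n

  transform-zero : ∀ {z} → z ≈ 0# → ∀ n (u : Seq) → transform z u n ≈ u n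
  transform-zero z≈0 zero    u = refl
  transform-zero z≈0 (suc n) u = begin
    transform _ (shift u) n + _ * transform _ u n  ≈⟨ +-cong (transform-zero z≈0 n (shift u)) (*-congʳ z≈0) ⟩
    u (suc n) + 0# * transform _ u n              ≈⟨ +-congˡ (zeroˡ _) ⟩
    u (suc n) + 0#                                ≈⟨ +-identityʳ _ ⟩
    u (suc n)                                     ∎

  transform-inverse : ∀ a n (u : Seq) → transform (- a) (transform a u) n ≈ u n
  transform-inverse a n u = trans (transform-∘ (- a) a n u) (transform-zero (-‿inverseˡ a) n u)

  binomialSumˡ : Carrier → Seq → Seq
  binomialSumˡ a u n = sumTo n (λ k → natMul (n C k) (pow a k * u (n ∸ k)))

  binomialSumʳ : Carrier → Seq → Seq
  binomialSumʳ a u n = sumTo n (λ k → natMul (n C k) (pow a (n ∸ k) * u k))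

  binomialSum-zero : ∀ a u → binomialSumˡ a u 0 ≈ u 0
  binomialSum-zero a u = trans (+-identityʳ _) (*-identityˡ _)

  binomialSumˡ-suc : ∀ a u n → binomialSumˡ a u (suc n) ≈ binomialSumˡ a (shift u) n + a * binomialSumˡ a u n
  binomialSumˡ-suc a u n = begin
    binomialSumˡ a u (suc n)                     ≈⟨ sumTo-suc-head n f ⟩
    f 0 + sumTo n (λ k → f (suc k))              ≈⟨ +-congˡ (sumTo-cong n (λ k _ → f[1+k]-pascal k)) ⟩
    f 0 + sumTo n (λ k → a * t k + t′ k)         ≈⟨ +-congˡ (sumTo-+ n _ t′) ⟩
    f 0 + (sumTo n (λ k → a * t k) + sumTo n t′) ≈⟨ +-congˡ (+-congʳ (*-distribˡ-sumTo n a t)) ⟨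
    f 0 + (a * binomialSumˡ a u n + sumTo n t′)  ≈⟨ +-Comm.x∙yz≈xz∙y _ _ _ ⟩
    (f 0 + sumTo n t′) + a * binomialSumˡ a u n  ≈⟨ +-congʳ (sumTo-suc-head n g) ⟨
    sumTo (suc n) g + a * binomialSumˡ a u n     ≈⟨ +-congʳ shifted-extended ⟨
    binomialSumˡ a (shift u) n + a * binomialSumˡ a u n ∎
    where
    f t t′ g : Seq
    f k  = natMul (suc n C k) (pow a k * u (suc n ∸ k))
    t k  = natMul (n C k) (pow a k * u (n ∸ k))
    t′ k = natMul (n C suc k) (pow a (suc k) * u (n ∸ k))
    g k  = natMul (n C k) (pow a k * u (suc n ∸ k))
    f[1+k]-pascal : ∀ k → f (suc k) ≈ a * t k + t′ k
    f[1+k]-pascal k = trans (pascal× n k _)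
      (+-congʳ (trans (×-congʳ (n C k) (*-assoc _ _ _)) (sym (×-comm-* (n C k) a _))))
    shifted-extended : binomialSumˡ a (shift u) n ≈ sumTo (suc n) g
    shifted-extended = sumTo-extendʳ n
      (λ k k≤n → ×-congʳ (n C k) (*-congˡ (reflexive (≡.cong u (≡.sym (ℕ.+-∸-assoc 1 k≤n))))))
      (nC[1+n]×≈0 n _)

  binomialSumʳ-suc : ∀ a u n → binomialSumʳ a u (suc n) ≈ binomialSumʳ a (shift u) n + a * binomialSumʳ a u n
  binomialSumʳ-suc a u n = begin
    binomialSumʳ a u (suc n)                          ≈⟨ sumTo-suc-head n f ⟩
    f 0 + sumTo n (λ k → f (suc k))                   ≈⟨ +-congˡ (sumTo-cong n (λ k _ → pascal× n k _)) ⟩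
    f 0 + sumTo n (λ k → t k + t′ k)                  ≈⟨ +-congˡ (sumTo-+ n t t′) ⟩
    f 0 + (binomialSumʳ a (shift u) n + sumTo n t′)   ≈⟨ +-Comm.x∙yz≈y∙xz _ _ _ ⟩
    binomialSumʳ a (shift u) n + (f 0 + sumTo n t′)   ≈⟨ +-congˡ (sumTo-suc-head n g) ⟨
    binomialSumʳ a (shift u) n + sumTo (suc n) g      ≈⟨ +-congˡ scaled-extended ⟨
    binomialSumʳ a (shift u) n + a * binomialSumʳ a u n ∎
    where
    f t t′ g : Seq
    f k  = natMul (suc n C k) (pow a (suc n ∸ k) * u k)
    t k  = natMul (n C k) (pow a (n ∸ k) * u (suc k))
    t′ k = natMul (n C suc k) (pow a (n ∸ k) * u (suc k))
    g k  = natMul (n C k) (pow a (suc n ∸ k) * u k)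
    a*term : ∀ k → k ≤ n → a * natMul (n C k) (pow a (n ∸ k) * u k) ≈ g k
    a*term k k≤n = begin
      a * natMul (n C k) (pow a (n ∸ k) * u k)      ≈⟨ ×-comm-* (n C k) a _ ⟩
      natMul (n C k) (a * (pow a (n ∸ k) * u k))    ≈⟨ ×-congʳ (n C k) (*-assoc _ _ _) ⟨
      natMul (n C k) (pow a (suc (n ∸ k)) * u k)
        ≈⟨ ×-congʳ (n C k) (*-congʳ (reflexive (≡.cong (pow a) (≡.sym (ℕ.+-∸-assoc 1 k≤n))))) ⟩
      g k                                           ∎
    scaled-extended : a * binomialSumʳ a u n ≈ sumTo (suc n) g
    scaled-extended = trans (*-distribˡ-sumTo n a _) (sumTo-extendʳ n a*term (nC[1+n]×≈0 n _))

  binomialSumˡ≈transform : ∀ a n u → binomialSumˡ a u n ≈ transform a u n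
  binomialSumˡ≈transform a = transform-unique a (binomialSumˡ a) (binomialSum-zero a) (binomialSumˡ-suc a)

  binomialSumʳ≈transform : ∀ a n u → binomialSumʳ a u n ≈ transform a u n
  binomialSumʳ≈transform a = transform-unique a (binomialSumʳ a) (binomialSum-zero a) (binomialSumʳ-suc a)

  ω≈transform : ∀ z y m → ω m z y ≈ transform y (λ j → fubini j z) m
  ω≈transform z y m =
    trans (sumTo-cong m (λ j _ → ×-assoc-* (m C j) _ _)) (binomialSumʳ≈transform y m _)

  signed-binomial-term : ∀ n k y w →
    ((pow y k * natMul (n C k) 1#) * pow (- 1#) k) * w ≈ natMul (n C k) (pow (- y) k * w)
  signed-binomial-term n k y w = begin
    ((pow y k * m) * pow (- 1#) k) * w  ≈⟨ *-congʳ (*-Comm.xy∙z≈y∙xz _ _ _) ⟩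
    (m * (pow y k * pow (- 1#) k)) * w  ≈⟨ *-congʳ (*-congˡ (^-distrib-* y (- 1#) k)) ⟨
    (m * pow (y * - 1#) k) * w          ≈⟨ *-congʳ (*-congˡ (^-congˡ k (trans (*-comm y (- 1#)) (-1*x≈-x y)))) ⟩
    (m * pow (- y) k) * w               ≈⟨ *-assoc _ _ _ ⟩
    m * (pow (- y) k * w)               ≈⟨ ×-assoc-* (n C k) 1# _ ⟩
    natMul (n C k) (1# * (pow (- y) k * w)) ≈⟨ ×-congʳ (n C k) (*-identityˡ _) ⟩
    natMul (n C k) (pow (- y) k * w)    ∎
    where m = natMul (n C k) 1#

  pow-*-fubini : ∀ x y z → z * y ≈ x → ∀ n → pow y n * fubini n z ≈ 𝔉 n x y
  pow-*-fubini x y z zy≈x n = trans (*-distribˡ-sumTo n (pow y n) _) (sumTo-cong n term)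
    where
    term : ∀ k → k ≤ n → pow y n * natMul (S₂ n k ℕ.* k !) (pow z k)
                       ≈ natMul (S₂ n k ℕ.* k !) (pow x k) * pow y (n ∸ k)
    term k k≤n = begin
      pow y n * natMul s (pow z k)                    ≈⟨ ×-comm-* s _ _ ⟩
      natMul s (pow y n * pow z k)
        ≈⟨ ×-congʳ s (*-congʳ (^-congʳ y (≡.sym (ℕ.m+[n∸m]≡n k≤n)))) ⟩
      natMul s (pow y (k ℕ.+ (n ∸ k)) * pow z k)      ≈⟨ ×-congʳ s (*-congʳ (^-homo-* y k (n ∸ k))) ⟩
      natMul s ((pow y k * pow y (n ∸ k)) * pow z k)  ≈⟨ ×-congʳ s (*-Comm.xy∙z≈xz∙y _ _ _) ⟩
      natMul s ((pow y k * pow z k) * pow y (n ∸ k))  ≈⟨ ×-congʳ s (*-congʳ (^-distrib-* y z k)) ⟨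
      natMul s (pow (y * z) k * pow y (n ∸ k))
        ≈⟨ ×-congʳ s (*-congʳ (^-congˡ k (trans (*-comm y z) zy≈x))) ⟩
      natMul s (pow x k * pow y (n ∸ k))              ≈⟨ ×-assoc-* s _ _ ⟨
      natMul s (pow x k) * pow y (n ∸ k)              ∎
      where s = S₂ n k ℕ.* k !

  x*y⁻¹*y≈x : ∀ x {y y⁻¹} → y * y⁻¹ ≈ 1# → (x * y⁻¹) * y ≈ x
  x*y⁻¹*y≈x x {y} {y⁻¹} yy⁻¹≈1 = begin
    (x * y⁻¹) * y  ≈⟨ *-assoc _ _ _ ⟩
    x * (y⁻¹ * y)  ≈⟨ *-congˡ (trans (*-comm y⁻¹ y) yy⁻¹≈1) ⟩
    x * 1#         ≈⟨ *-identityʳ x ⟩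
    x              ∎

mainTheorem5 : {c ℓ : Level} (R : CommutativeRing c ℓ) →
    let open CommutativeRing R
        open FubiniDefs R
    in (x y y⁻¹ : Carrier) → ¬ (x ≈ 0#) → ¬ (y ≈ 0#) → y * y⁻¹ ≈ 1# →
       (n : ℕ) →
       𝔉 n x y ≈ pow y n * sumTo n (λ k → ((pow y k * natMul (n C k) 1#) * pow (- 1#) k) * ω (n ∸ k) (x * y⁻¹) y)
mainTheorem5 R x y y⁻¹ _ _ yy⁻¹≈1 n = sym (begin
  pow y n * sumTo n (λ k → ((pow y k * natMul (n C k) 1#) * pow (- 1#) k) * ω (n ∸ k) z y)
    ≈⟨ *-congˡ (sumTo-cong n (λ k _ → signed-binomial-term n k y _)) ⟩
  pow y n * binomialSumˡ (- y) (λ m → ω m z y) n  ≈⟨ *-congˡ (binomialSumˡ≈transform (- y) n _) ⟩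
  pow y n * transform (- y) (λ m → ω m z y) n     ≈⟨ *-congˡ (transform-cong (- y) n (λ m → ω≈transform z y m)) ⟩
  pow y n * transform (- y) (transform y F) n     ≈⟨ *-congˡ (transform-inverse y n F) ⟩
  pow y n * fubini n z                            ≈⟨ pow-*-fubini x y z (x*y⁻¹*y≈x x yy⁻¹≈1) n ⟩
  𝔉 n x y                                         ∎)
  where
  open CommutativeRing R
  open FubiniDefs R
  open BinomialTransform R
  open import Relation.Binary.Reasoning.Setoid setoid
  z : Carrier
  z = x * y⁻¹
  F : Seq
  F j = fubini j z
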